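{- Let $I$ and $J$ be independent sets in a connected claw-free graph $G$ with $|I|=|J|$. If $G[I\Delta J]$ contains no cycles, then $I\leftrightarrow_{\mathrm{TS}} J$.
   Context: Graphs are finite and simple; claw-free means no induced $K_{1,3}$. A TS-sequence is a sequence $I_0,\ldots,I_m$ of independent sets such that each $I_{i+1}$ arises from $I_i$ by a move $u\to v$: $uv\in E(G)$, $I_i\setminus I_{i+1}=\{u\}$, $I_{i+1}\setminus I_i=\{v\}$. $I\leftrightarrow_{\mathrm{TS}} J$ means a TS-sequence from $I$ to $J$ exists. -}

module Defs where

open import Data.Nat using (ℕ; _≥_)
open import Data.Bool using (Bool; true; false)
open import Data.Fin using (Fin)
open import Data.Fin.Subset using (Subset; _∈_; _∉_; _∪_; _─_; _-_; ⁅_⁆; ∣_∣)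
open import Data.List using (List; []; _∷_; _∷ʳ_; length)
open import Data.List.Relation.Unary.All using (All)
open import Data.List.Relation.Unary.Linked using (Linked)
open import Data.List.Relation.Unary.Unique.Propositional using (Unique)
open import Data.Product using (Σ; ∃; ∃-syntax; _×_; _,_)
open import Relation.Binary.PropositionalEquality using (_≡_; _≢_)
open import Relation.Nullary using (¬_)

record Graph (n : ℕ) : Set where
  field
    adj   : Fin n → Fin n → Bool
    sym   : ∀ u v → adj u v ≡ adj v u
    irrfl : ∀ u → adj u u ≡ false

open Graph public

E : ∀ {n} → Graph n → Fin n → Fin n → Set
E G u v = adj G u v ≡ true

data Walk {n} (G : Graph n) : Fin n → Fin n → Set where
  here : ∀ {u} → Walk G u u
  step : ∀ {u w v} → E G u w → Walk G w v → Walk G u v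

Connected : ∀ {n} → Graph n → Set
Connected G = ∀ u v → Walk G u v

InducedClaw : ∀ {n} → Graph n → Fin n → Fin n → Fin n → Fin n → Set
InducedClaw G c a b d =
  E G c a × E G c b × E G c d ×
  a ≢ b × a ≢ d × b ≢ d ×
  ¬ E G a b × ¬ E G a d × ¬ E G b d

ClawFree : ∀ {n} → Graph n → Set
ClawFree G = ∀ c a b d → ¬ InducedClaw G c a b d

Independent : ∀ {n} → Graph n → Subset n → Set
Independent G I = ∀ u v → u ∈ I → v ∈ I → ¬ E G u v

_Δ_ : ∀ {n} → Subset n → Subset n → Subset n
I Δ J = (I ─ J) ∪ (J ─ I)

-- A cycle in the induced subgraph G[S]: distinct vertices x, y₁, …, yₖ
-- (k ≥ 2, so at least 3 vertices) all in S, with x y₁ … yₖ x consecutively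
-- adjacent.  (Edges of G[S] are exactly edges of G between vertices of S.)
CycleIn : ∀ {n} → Graph n → Subset n → Set
CycleIn {n} G S =
  Σ (Fin n) λ x → Σ (List (Fin n)) λ ys →
    length ys ≥ 2 × Unique (x ∷ ys) × All (_∈ S) (x ∷ ys) ×
    Linked (E G) (x ∷ (ys ∷ʳ x))

-- A TS move u → v from I to I' : uv ∈ E(G), I ∖ I' = {u}, I' ∖ I = {v},
-- i.e. u ∈ I, v ∉ I and I' = (I ∖ {u}) ∪ {v}.
TSMove : ∀ {n} → Graph n → Subset n → Subset n → Set
TSMove {n} G I I' =
  Σ (Fin n) λ u → Σ (Fin n) λ v →
    E G u v × u ∈ I × v ∉ I × I' ≡ (I - u) ∪ ⁅ v ⁆

data TSSeq {n} (G : Graph n) : Subset n → Subset n → Set where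
  done : ∀ {I} → Independent G I → TSSeq G I I
  move : ∀ {I I' J} → Independent G I → TSMove G I I' → TSSeq G I' J → TSSeq G I J

_⟷TS[_]_ : ∀ {n} → Subset n → Graph n → Subset n → Set
I ⟷TS[ G ] J = TSSeq G I J

-- Induct on |I Δ J|.  Call a ∈ I ∖ J and b ∈ J ∖ I exchangeable if b has no
-- neighbour in I − a (or, symmetrically, a has none in J − b); then the token
-- on a can be slid to b along a walk from b to a.  If the vertex c after b on
-- the walk has a neighbour y in I, claw-freeness makes y unique, so y moves to
-- b via c, and the token on a must then reach y along a walk which
-- claw-freeness (applied at c) makes shorter than the original one.  Each such
-- slide shrinks I Δ J and keeps it acyclic.  If no pair is exchangeable, every
-- vertex of G[I Δ J] with a neighbour there has a second one, so extending a
-- path greedily closes a cycle.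
module Submission where

open import Defs hiding (sym)
open import Data.Bool using (true) renaming (_≟_ to _≟ᵇ_)
open import Data.Empty using (⊥-elim)
open import Data.Fin using (Fin; zero; suc; _≟_)
open import Data.Fin.Properties using (any?; all?)
open import Data.Fin.Subset
  using (Subset; _∈_; _∉_; _⊆_; _⊂_; _∪_; _─_; _-_; ⁅_⁆; ∣_∣; Empty; inside; outside)
open import Data.Fin.Subset.Properties
  using ( _∈?_; x∈p∪q⁻; x∈p∪q⁺; x∈p∧x∉q⇒x∈p─q; x∈p∧x≢y⇒x∈p-y; p─q⊆p; x∉⁅y⁆⇒x≢y
        ; x∈⁅x⁆; x∈⁅y⁆⇒x≡y; ∪-comm; ∪-identityʳ; p─⊥≡p; ⊆-antisym; p⊂q⇒p⊆q
        ; p⊂q⇒∣p∣<∣q∣; ∣p∣≤n; ∣p∣≡n⇒p≡⊤; ∈⊤; nonempty? )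
open import Data.List using (List; []; _∷_; _∷ʳ_)
open import Data.Vec using (_∷_; here; there)
open import Data.List.Membership.Propositional using () renaming (_∈_ to _∈ₗ_)
open import Data.List.Relation.Unary.All as All using (All; []; _∷_)
open import Data.List.Relation.Unary.AllPairs using ([]; _∷_)
open import Data.List.Relation.Unary.Any using (here; there)
open import Data.List.Relation.Unary.Linked using (Linked; [-]; _∷_)
open import Data.List.Relation.Unary.Unique.Propositional using (Unique)
open import Data.Nat using (ℕ; zero; suc; _+_; _≤_; _<_; z≤n; s≤s)
open import Data.Nat.Induction using (<-wellFounded)
open import Data.Nat.Properties using (≤-refl; ≤-antisym; ≤-<-trans; <-irrefl; n≤1+n; m≤m+n; +-suc)
open import Data.Product using (Σ; ∃-syntax; _×_; _,_; proj₁; proj₂)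
open import Data.Sum using (_⊎_; inj₁; inj₂)
open import Function using (_∘_)
open import Induction.WellFounded using (Acc; acc)
open import Relation.Binary.PropositionalEquality using (_≡_; _≢_; refl; sym; trans; cong; subst; subst₂)
open import Relation.Nullary using (¬_; Dec; yes; no)
open import Relation.Nullary.Decidable using (_×-dec_; _⊎-dec_; _→-dec_; ¬?)

private
  variable
    n : ℕ

x∈p─q⇒x∉q : ∀ {x : Fin n} (p q : Subset n) → x ∈ p ─ q → x ∉ q
x∈p─q⇒x∉q {x = zero}  (s ∷ p) (inside ∷ q)  ()
x∈p─q⇒x∉q {x = zero}  (s ∷ p) (outside ∷ q) here      = λ ()
x∈p─q⇒x∉q {x = suc x} (s ∷ p) (t ∷ q)       (there m) = λ { (there m′) → x∈p─q⇒x∉q p q m m′ }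

x∈p─q⁻ : ∀ {x : Fin n} {p q : Subset n} → x ∈ p ─ q → x ∈ p × x ∉ q
x∈p─q⁻ {p = p} {q} m = p─q⊆p p q m , x∈p─q⇒x∉q p q m

x∈p-y⁻ : ∀ {x y : Fin n} {p : Subset n} → x ∈ p - y → x ∈ p × x ≢ y
x∈p-y⁻ m with x∈p─q⁻ m
... | x∈p , x∉⁅y⁆ = x∈p , x∉⁅y⁆⇒x≢y x∉⁅y⁆

x∈p⇒suc∣p-x∣≡∣p∣ : ∀ (p : Subset n) x → x ∈ p → suc ∣ p - x ∣ ≡ ∣ p ∣
x∈p⇒suc∣p-x∣≡∣p∣ (inside ∷ p)  zero    here      = cong (suc ∘ ∣_∣) (p─⊥≡p p)
x∈p⇒suc∣p-x∣≡∣p∣ (inside ∷ p)  (suc x) (there m) = cong suc (x∈p⇒suc∣p-x∣≡∣p∣ p x m)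
x∈p⇒suc∣p-x∣≡∣p∣ (outside ∷ p) (suc x) (there m) = x∈p⇒suc∣p-x∣≡∣p∣ p x m

x∉p⇒∣p∪⁅x⁆∣≡suc∣p∣ : ∀ (p : Subset n) x → x ∉ p → ∣ p ∪ ⁅ x ⁆ ∣ ≡ suc ∣ p ∣
x∉p⇒∣p∪⁅x⁆∣≡suc∣p∣ (inside ∷ p)  zero    x∉p = ⊥-elim (x∉p here)
x∉p⇒∣p∪⁅x⁆∣≡suc∣p∣ (outside ∷ p) zero    x∉p = cong (suc ∘ ∣_∣) (∪-identityʳ p)
x∉p⇒∣p∪⁅x⁆∣≡suc∣p∣ (inside ∷ p)  (suc x) x∉p = cong suc (x∉p⇒∣p∪⁅x⁆∣≡suc∣p∣ p x (x∉p ∘ there))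
x∉p⇒∣p∪⁅x⁆∣≡suc∣p∣ (outside ∷ p) (suc x) x∉p = x∉p⇒∣p∪⁅x⁆∣≡suc∣p∣ p x (x∉p ∘ there)

Empty[p─q]⇒p⊆q : ∀ {p q : Subset n} → Empty (p ─ q) → p ⊆ q
Empty[p─q]⇒p⊆q {q = q} empty {x} x∈p with x ∈? q
... | yes x∈q = x∈q
... | no  x∉q = ⊥-elim (empty (x , x∈p∧x∉q⇒x∈p─q x∈p x∉q))

p⊆q∧∣p∣≡∣q∣⇒p≡q : ∀ {p q : Subset n} → p ⊆ q → ∣ p ∣ ≡ ∣ q ∣ → p ≡ q
p⊆q∧∣p∣≡∣q∣⇒p≡q {p = p} p⊆q ∣p∣≡∣q∣ = ⊆-antisym p⊆q q⊆p
  where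
  q⊆p : _ ⊆ p
  q⊆p {x} x∈q with x ∈? p
  ... | yes x∈p = x∈p
  ... | no  x∉p = ⊥-elim (<-irrefl ∣p∣≡∣q∣ (p⊂q⇒∣p∣<∣q∣ (p⊆q , x , x∈q , x∉p)))

n≤∣p∣⇒x∈p : ∀ {x : Fin n} (p : Subset n) → n ≤ ∣ p ∣ → x ∈ p
n≤∣p∣⇒x∈p {x = x} p n≤∣p∣ = subst (x ∈_) (sym (∣p∣≡n⇒p≡⊤ (≤-antisym (∣p∣≤n p) n≤∣p∣))) ∈⊤

Δ-comm : ∀ (I J : Subset n) → I Δ J ≡ J Δ I
Δ-comm I J = ∪-comm (I ─ J) (J ─ I)

slide : Subset n → Fin n → Fin n → Subset n
slide I u v = (I - u) ∪ ⁅ v ⁆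

module _ {I : Subset n} {u v : Fin n} where

  x∈slide⁻ : ∀ {x} → x ∈ slide I u v → (x ∈ I × x ≢ u) ⊎ x ≡ v
  x∈slide⁻ m with x∈p∪q⁻ (I - u) ⁅ v ⁆ m
  ... | inj₁ x∈I-u = inj₁ (x∈p-y⁻ x∈I-u)
  ... | inj₂ x∈⁅v⁆ = inj₂ (x∈⁅y⁆⇒x≡y v x∈⁅v⁆)

  x∈slide⁺ : ∀ {x} → x ∈ I → x ≢ u → x ∈ slide I u v
  x∈slide⁺ x∈I x≢u = x∈p∪q⁺ (inj₁ (x∈p∧x≢y⇒x∈p-y x∈I x≢u))

  v∈slide : v ∈ slide I u v
  v∈slide = x∈p∪q⁺ (inj₂ (x∈⁅x⁆ v))

  u∉slide : u ∈ I → v ∉ I → u ∉ slide I u v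
  u∉slide u∈I v∉I m with x∈slide⁻ m
  ... | inj₁ (_ , u≢u) = u≢u refl
  ... | inj₂ refl      = v∉I u∈I

  ∣slide∣ : u ∈ I → v ∉ I → ∣ slide I u v ∣ ≡ ∣ I ∣
  ∣slide∣ u∈I v∉I = trans (x∉p⇒∣p∪⁅x⁆∣≡suc∣p∣ (I - u) v (v∉I ∘ proj₁ ∘ x∈p-y⁻))
                          (x∈p⇒suc∣p-x∣≡∣p∣ I u u∈I)

  slide-Δ⊂ : ∀ {J} → u ∈ I ─ J → v ∈ J → slide I u v Δ J ⊂ I Δ J
  slide-Δ⊂ {J} u∈I─J v∈J = shrinks , u , x∈p∪q⁺ (inj₁ u∈I─J) , u∉
    where
    u∈I : u ∈ I
    u∈I = proj₁ (x∈p─q⁻ u∈I─J)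
    u∉J : u ∉ J
    u∉J = proj₂ (x∈p─q⁻ u∈I─J)
    shrinks : slide I u v Δ J ⊆ I Δ J
    shrinks m with x∈p∪q⁻ (slide I u v ─ J) (J ─ slide I u v) m
    ... | inj₁ x∈slide─J with x∈p─q⁻ x∈slide─J
    ...   | x∈slide , x∉J with x∈slide⁻ x∈slide
    ...     | inj₁ (x∈I , _) = x∈p∪q⁺ (inj₁ (x∈p∧x∉q⇒x∈p─q x∈I x∉J))
    ...     | inj₂ refl      = ⊥-elim (x∉J v∈J)
    shrinks {x} m | inj₂ x∈J─slide with x∈p─q⁻ x∈J─slide
    ...   | x∈J , x∉slide = x∈p∪q⁺ (inj₂ (x∈p∧x∉q⇒x∈p─q x∈J x∉I))
      where
      x∉I : x ∉ I
      x∉I x∈I with x ≟ u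
      ... | yes refl = u∉J x∈J
      ... | no  x≢u  = x∉slide (x∈slide⁺ x∈I x≢u)
    u∉ : u ∉ slide I u v Δ J
    u∉ m with x∈p∪q⁻ (slide I u v ─ J) (J ─ slide I u v) m
    ... | inj₂ u∈J─slide = u∉J (proj₁ (x∈p─q⁻ u∈J─slide))
    ... | inj₁ u∈slide─J with x∈slide⁻ (proj₁ (x∈p─q⁻ u∈slide─J))
    ...   | inj₁ (_ , u≢u) = u≢u refl
    ...   | inj₂ refl      = u∉J v∈J

slide-involutive : ∀ {I : Subset n} {u v} → u ∈ I → v ∉ I → slide (slide I u v) v u ≡ I
slide-involutive {I = I} {u} {v} u∈I v∉I = ⊆-antisym ⊆I I⊆
  where
  ⊆I : slide (slide I u v) v u ⊆ I
  ⊆I m with x∈slide⁻ m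
  ... | inj₂ refl = u∈I
  ... | inj₁ (m′ , x≢v) with x∈slide⁻ m′
  ...   | inj₁ (x∈I , _) = x∈I
  ...   | inj₂ refl      = ⊥-elim (x≢v refl)
  I⊆ : I ⊆ slide (slide I u v) v u
  I⊆ {x} x∈I with x ≟ u
  ... | yes refl = v∈slide
  ... | no  x≢u  = x∈slide⁺ (x∈slide⁺ x∈I x≢u) λ { refl → v∉I x∈I }

slide-trans : ∀ {I : Subset n} {u w v} → w ∉ I → slide (slide I u w) w v ≡ slide I u v
slide-trans {I = I} {u} {w} {v} w∉I = ⊆-antisym ⊆ʳ ⊆ˡ
  where
  ⊆ʳ : slide (slide I u w) w v ⊆ slide I u v
  ⊆ʳ m with x∈slide⁻ m
  ... | inj₂ refl = v∈slide
  ... | inj₁ (m′ , x≢w) with x∈slide⁻ m′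
  ...   | inj₁ (x∈I , x≢u) = x∈slide⁺ x∈I x≢u
  ...   | inj₂ refl        = ⊥-elim (x≢w refl)
  ⊆ˡ : slide I u v ⊆ slide (slide I u w) w v
  ⊆ˡ m with x∈slide⁻ m
  ... | inj₂ refl        = v∈slide
  ... | inj₁ (x∈I , x≢u) = x∈slide⁺ (x∈slide⁺ x∈I x≢u) λ { refl → w∉I x∈I }

slide-push : ∀ {I : Subset n} {u y v} → y ∈ I → y ≢ u → v ≢ u →
             slide (slide I y v) u y ≡ slide I u v
slide-push {I = I} {u} {y} {v} y∈I y≢u v≢u = ⊆-antisym ⊆ʳ ⊆ˡ
  where
  ⊆ʳ : slide (slide I y v) u y ⊆ slide I u v
  ⊆ʳ m with x∈slide⁻ m
  ... | inj₂ refl = x∈slide⁺ y∈I y≢u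
  ... | inj₁ (m′ , x≢u) with x∈slide⁻ m′
  ...   | inj₁ (x∈I , _) = x∈slide⁺ x∈I x≢u
  ...   | inj₂ refl      = v∈slide
  ⊆ˡ : slide I u v ⊆ slide (slide I y v) u y
  ⊆ˡ m with x∈slide⁻ m
  ... | inj₂ refl = x∈slide⁺ v∈slide v≢u
  ⊆ˡ {x} m | inj₁ (x∈I , x≢u) with x ≟ y
  ...   | yes refl = v∈slide
  ...   | no  x≢y  = x∈slide⁺ (x∈slide⁺ x∈I x≢y) x≢u

module _ {A : Set} where

  takeUntil : ∀ {w} (xs : List A) → w ∈ₗ xs → List A
  takeUntil (_ ∷ _)  (here _)  = []
  takeUntil (x ∷ xs) (there m) = x ∷ takeUntil xs m

  takeUntil-all : ∀ {P : A → Set} {w xs} → All P xs → (m : w ∈ₗ xs) → All P (takeUntil xs m)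
  takeUntil-all (_ ∷ _)   (here _)  = []
  takeUntil-all (px ∷ ps) (there m) = px ∷ takeUntil-all ps m

  takeUntil-unique : ∀ {w xs} → Unique xs → (m : w ∈ₗ xs) → Unique (w ∷ takeUntil xs m)
  takeUntil-unique (_ ∷ _) (here refl) = [] ∷ []
  takeUntil-unique (x≢xs ∷ unique) (there m) with takeUntil-unique unique m
  ... | w≢prefix ∷ prefix-unique =
    ((λ { refl → All.lookup x≢xs m refl }) ∷ w≢prefix) ∷ takeUntil-all x≢xs m ∷ prefix-unique

  takeUntil-linked : ∀ {R : A → A → Set} {x w xs} → Linked R (x ∷ xs) → (m : w ∈ₗ xs) →
                     Linked R (x ∷ (takeUntil xs m ∷ʳ w))
  takeUntil-linked (r ∷ _)      (here refl) = r ∷ [-]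
  takeUntil-linked (r ∷ linked) (there m)   = r ∷ takeUntil-linked linked m

walkLength : ∀ {G : Graph n} {u v} → Walk G u v → ℕ
walkLength here       = 0
walkLength (step _ w) = suc (walkLength w)

NoNeighbourIn : Graph n → Subset n → Fin n → Set
NoNeighbourIn G S v = ∀ x → x ∈ S → ¬ E G x v

NoLeaf : Graph n → Subset n → Set
NoLeaf G S = ∀ {v p} → v ∈ S → p ∈ S → E G v p → ∃[ w ] w ∈ S × E G v w × w ≢ p

PathIn : Graph n → Subset n → List (Fin n) → Set
PathIn G S xs = Unique xs × All (_∈ S) xs × Linked (E G) xs

module _ (G : Graph n) where

  E-sym : ∀ {u v} → E G u v → E G v u
  E-sym {u} {v} e = trans (sym (Graph.sym G u v)) e

  E-irrefl : ∀ {u} → ¬ E G u u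
  E-irrefl {u} e with trans (sym e) (irrfl G u)
  ... | ()

  E? : ∀ u v → Dec (E G u v)
  E? u v = adj G u v ≟ᵇ true

  noNeighbourIn? : ∀ S v → Dec (NoNeighbourIn G S v)
  noNeighbourIn? S v = all? λ x → x ∈? S →-dec ¬? (E? x v)

  ¬NoNeighbourIn⇒neighbour : ∀ {S v} → ¬ NoNeighbourIn G S v → ∃[ x ] x ∈ S × E G x v
  ¬NoNeighbourIn⇒neighbour {S} {v} ¬none with any? (λ x → x ∈? S ×-dec E? x v)
  ... | yes neighbour = neighbour
  ... | no  ¬found    = ⊥-elim (¬none λ x x∈S xv → ¬found (x , x∈S , xv))

  NoNeighbourIn-mono : ∀ {S T v} → S ⊆ T → NoNeighbourIn G T v → NoNeighbourIn G S v
  NoNeighbourIn-mono S⊆T none x x∈S = none x (S⊆T x∈S)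

  NoNeighbourIn⇒neighbour∉ : ∀ {I v c} → NoNeighbourIn G I v → E G v c → c ∉ I
  NoNeighbourIn⇒neighbour∉ none vc c∈I = none _ c∈I (E-sym vc)

  NoNeighbourIn-insert : ∀ {I u v} → NoNeighbourIn G (I - u) v → ¬ E G u v → NoNeighbourIn G I v
  NoNeighbourIn-insert {u = u} none ¬uv x x∈I xv with x ≟ u
  ... | yes refl = ¬uv xv
  ... | no  x≢u  = none x (x∈p∧x≢y⇒x∈p-y x∈I x≢u) xv

  slide-independent : ∀ {I u v} → Independent G I → NoNeighbourIn G (I - u) v →
                      Independent G (slide I u v)
  slide-independent indI none x y x∈ y∈ xy with x∈slide⁻ x∈ | x∈slide⁻ y∈
  ... | inj₁ (x∈I , x≢u) | inj₁ (y∈I , _)   = indI x y x∈I y∈I xy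
  ... | inj₁ (x∈I , x≢u) | inj₂ refl        = none x (x∈p∧x≢y⇒x∈p-y x∈I x≢u) xy
  ... | inj₂ refl        | inj₁ (y∈I , y≢u) = none y (x∈p∧x≢y⇒x∈p-y y∈I y≢u) (E-sym xy)
  ... | inj₂ refl        | inj₂ refl        = E-irrefl xy

  TSSeq-independentˡ : ∀ {I J} → I ⟷TS[ G ] J → Independent G I
  TSSeq-independentˡ (done indI)     = indI
  TSSeq-independentˡ (move indI _ _) = indI

  TSSeq-independentʳ : ∀ {I J} → I ⟷TS[ G ] J → Independent G J
  TSSeq-independentʳ (done indJ)   = indJ
  TSSeq-independentʳ (move _ _ s) = TSSeq-independentʳ s

  TSSeq-trans : ∀ {I J K} → I ⟷TS[ G ] J → J ⟷TS[ G ] K → I ⟷TS[ G ] K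
  TSSeq-trans (done _)        t = t
  TSSeq-trans (move indI m s) t = move indI m (TSSeq-trans s t)

  TSMove-sym : ∀ {I J} → TSMove G I J → TSMove G J I
  TSMove-sym (u , v , uv , u∈I , v∉I , refl) =
    v , u , E-sym uv , v∈slide , u∉slide u∈I v∉I , sym (slide-involutive u∈I v∉I)

  TSSeq-sym : ∀ {I J} → I ⟷TS[ G ] J → J ⟷TS[ G ] I
  TSSeq-sym (done indI)     = done indI
  TSSeq-sym (move indI m s) =
    TSSeq-trans (TSSeq-sym s) (move (TSSeq-independentˡ s) (TSMove-sym m) (done indI))

  slide-move : ∀ {I u v} → Independent G I → E G u v → u ∈ I → v ∉ I →
               NoNeighbourIn G (I - u) v → I ⟷TS[ G ] slide I u v
  slide-move indI uv u∈I v∉I none =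
    move indI (_ , _ , uv , u∈I , v∉I , refl) (done (slide-independent indI none))

  slide-extend : ∀ {I u c v} → c ∉ I → v ∉ I → E G c v → NoNeighbourIn G (I - u) v →
                 I ⟷TS[ G ] slide I u c → I ⟷TS[ G ] slide I u v
  slide-extend {I} {u} {c} {v} c∉I v∉I cv none s =
    subst (I ⟷TS[ G ]_) (slide-trans c∉I)
      (TSSeq-trans s (slide-move (TSSeq-independentʳ s) cv v∈slide v∉ none′))
    where
    v∉ : v ∉ slide I u c
    v∉ m with x∈slide⁻ m
    ... | inj₁ (v∈I , _) = v∉I v∈I
    ... | inj₂ refl      = E-irrefl cv
    none′ : NoNeighbourIn G (slide I u c - c) v
    none′ x m with x∈p-y⁻ m
    ... | x∈ , x≢c with x∈slide⁻ x∈
    ...   | inj₁ (x∈I , x≢u) = none x (x∈p∧x≢y⇒x∈p-y x∈I x≢u)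
    ...   | inj₂ refl        = ⊥-elim (x≢c refl)

  reroute : ∀ {v d u} → d ≡ v ⊎ E G v d → (W : Walk G d u) →
            Σ (Walk G v u) λ w → walkLength w ≤ suc (walkLength W)
  reroute (inj₁ refl) W = W , n≤1+n _
  reroute (inj₂ vd)   W = step vd W , ≤-refl

  module _ (claw-free : ClawFree G) where

    claw-free-adjacent-pair : ∀ {c x y z} → E G c x → E G c y → E G c z →
      x ≢ y → x ≢ z → y ≢ z → E G x y ⊎ E G x z ⊎ E G y z
    claw-free-adjacent-pair {x = x} {y} {z} cx cy cz x≢y x≢z y≢z with E? x y | E? x z | E? y z
    ... | yes xy | _      | _      = inj₁ xy
    ... | no _   | yes xz | _      = inj₂ (inj₁ xz)
    ... | no _   | no _   | yes yz = inj₂ (inj₂ yz)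
    ... | no ¬xy | no ¬xz | no ¬yz =
      ⊥-elim (claw-free _ x y z (cx , cy , cz , x≢y , x≢z , y≢z , ¬xy , ¬xz , ¬yz))

    claw-free⇒unique-neighbour : ∀ {I c v y} → Independent G I → v ∉ I → NoNeighbourIn G I v →
      E G c v → E G c y → y ∈ I → NoNeighbourIn G (I - y) c
    claw-free⇒unique-neighbour indI v∉I none cv cy y∈I z z∈I-y zc
      with x∈p-y⁻ z∈I-y
    ... | z∈I , z≢y
      with claw-free-adjacent-pair cy (E-sym zc) cv (z≢y ∘ sym)
             (λ { refl → v∉I y∈I }) (λ { refl → v∉I z∈I })
    ... | inj₁ yz        = indI _ _ y∈I z∈I yz
    ... | inj₂ (inj₁ yv) = none _ y∈I yv
    ... | inj₂ (inj₂ zv) = none _ z∈I zv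

    claw-free-dominating : ∀ {c d v y} → E G c d → E G c v → E G c y → v ≢ y → ¬ E G v y →
      (d ≡ v ⊎ E G v d) ⊎ (d ≡ y ⊎ E G y d)
    claw-free-dominating {d = d} {v} {y} cd cv cy v≢y ¬vy with d ≟ v | d ≟ y
    ... | yes d≡v | _       = inj₁ (inj₁ d≡v)
    ... | no _    | yes d≡y = inj₂ (inj₁ d≡y)
    ... | no d≢v  | no d≢y  with claw-free-adjacent-pair cd cv cy d≢v d≢y v≢y
    ...   | inj₁ dv        = inj₁ (inj₂ (E-sym dv))
    ...   | inj₂ (inj₁ dy) = inj₂ (inj₂ (E-sym dy))
    ...   | inj₂ (inj₂ vy) = ⊥-elim (¬vy vy)

    SlideAlongWalksBelow : ℕ → Set
    SlideAlongWalksBelow k = ∀ {I u v} (w : Walk G v u) → walkLength w < k →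
      Independent G I → u ∈ I → v ∉ I → NoNeighbourIn G (I - u) v → I ⟷TS[ G ] slide I u v

    slide-to-neighbour : ∀ {I v c y} → Independent G I → v ∉ I → NoNeighbourIn G I v →
      E G v c → E G c y → y ∈ I → I ⟷TS[ G ] slide I y v
    slide-to-neighbour {I} {c = c} {y} indI v∉I none vc cy y∈I =
      slide-extend c∉I v∉I (E-sym vc) (NoNeighbourIn-mono (p─q⊆p I ⁅ y ⁆) none)
        (slide-move indI (E-sym cy) y∈I c∉I
          (claw-free⇒unique-neighbour indI v∉I none (E-sym vc) cy y∈I))
      where
      c∉I : c ∉ I
      c∉I = NoNeighbourIn⇒neighbour∉ none vc

    slide-via-neighbour : ∀ {k I u v c d y} → SlideAlongWalksBelow k →
      E G v c → E G c d → (W : Walk G d u) → suc (walkLength W) < k →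
      Independent G I → u ∈ I → v ∉ I → NoNeighbourIn G I v → E G c y → y ∈ I →
      I ⟷TS[ G ] slide I u v
    slide-via-neighbour {I = I} {u} {v} {y = y} IH vc cd W lt indI u∈I v∉I none cy y∈I
      with y ≟ u | claw-free-dominating cd (E-sym vc) cy (λ { refl → v∉I y∈I }) (none y y∈I ∘ E-sym)
    ... | yes refl | _           = slide-to-neighbour indI v∉I none vc cy y∈I
    ... | no y≢u   | inj₁ from-v =
      IH (proj₁ (reroute from-v W)) (≤-<-trans (proj₂ (reroute from-v W)) lt)
         indI u∈I v∉I (NoNeighbourIn-mono (p─q⊆p I ⁅ u ⁆) none)
    ... | no y≢u   | inj₂ from-y =
      TSSeq-trans to-y (subst (slide I y v ⟷TS[ G ]_) (slide-push y∈I y≢u v≢u)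
        (IH (proj₁ (reroute from-y W)) (≤-<-trans (proj₂ (reroute from-y W)) lt)
            (TSSeq-independentʳ to-y) (x∈slide⁺ u∈I (y≢u ∘ sym)) (u∉slide y∈I v∉I)
            (NoNeighbourIn-mono (p─q⊆p _ ⁅ u ⁆) y-isolated)))
      where
      to-y : I ⟷TS[ G ] slide I y v
      to-y = slide-to-neighbour indI v∉I none vc cy y∈I
      v≢u : v ≢ u
      v≢u refl = v∉I u∈I
      y-isolated : NoNeighbourIn G (slide I y v) y
      y-isolated x x∈ xy with x∈slide⁻ x∈
      ... | inj₁ (x∈I , _) = indI x y x∈I y∈I xy
      ... | inj₂ refl      = none y y∈I (E-sym xy)

    slide-detour : ∀ {k I u v c d} → SlideAlongWalksBelow k →
      E G v c → E G c d → (W : Walk G d u) → suc (walkLength W) < k →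
      Independent G I → u ∈ I → v ∉ I → NoNeighbourIn G I v → I ⟷TS[ G ] slide I u v
    slide-detour {I = I} {u} {v} {c} IH vc cd W lt indI u∈I v∉I none
      with any? (λ y → y ∈? I ×-dec E? c y)
    ... | yes (y , y∈I , cy) = slide-via-neighbour IH vc cd W lt indI u∈I v∉I none cy y∈I
    ... | no  ¬found         =
      slide-extend c∉I v∉I (E-sym vc) (NoNeighbourIn-mono (p─q⊆p I ⁅ u ⁆) none)
        (IH (step cd W) lt indI u∈I c∉I λ x x∈ xc → ¬found (x , proj₁ (x∈p-y⁻ x∈) , E-sym xc))
      where
      c∉I : c ∉ I
      c∉I = NoNeighbourIn⇒neighbour∉ none vc

    slide-along-walk-step : ∀ {k} → SlideAlongWalksBelow k → SlideAlongWalksBelow (suc k)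
    slide-along-walk-step IH here _ _ u∈I v∉I _ = ⊥-elim (v∉I u∈I)
    slide-along-walk-step IH (step vu here) _ indI u∈I v∉I none =
      slide-move indI (E-sym vu) u∈I v∉I none
    slide-along-walk-step IH {u = u} {v} (step vc (step cd W)) (s≤s lt) indI u∈I v∉I none
      with E? v u
    ... | yes vu  = slide-move indI (E-sym vu) u∈I v∉I none
    ... | no  ¬vu = slide-detour IH vc cd W lt indI u∈I v∉I (NoNeighbourIn-insert none (¬vu ∘ E-sym))

    slide-along-walks-below : ∀ k → SlideAlongWalksBelow k
    slide-along-walks-below zero    _ ()
    slide-along-walks-below (suc k) = slide-along-walk-step (slide-along-walks-below k)

    slide-along-walk : ∀ {I u v} → Walk G v u → Independent G I → u ∈ I → v ∉ I →
                       NoNeighbourIn G (I - u) v → I ⟷TS[ G ] slide I u v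
    slide-along-walk w = slide-along-walks-below (suc (walkLength w)) w ≤-refl

  CycleIn-mono : ∀ {S T} → S ⊆ T → CycleIn G S → CycleIn G T
  CycleIn-mono S⊆T (x , ys , long , unique , inS , linked) =
    x , ys , long , unique , All.map S⊆T inS , linked

  close-cycle : ∀ {S x y w ys} → PathIn G S (x ∷ y ∷ ys) → E G w x → w ∈ₗ ys → CycleIn G S
  close-cycle {x = x} {y} {w} {ys} (unique , inS , linked) wx m =
    w , takeUntil (x ∷ y ∷ ys) m″ , s≤s (s≤s z≤n) , takeUntil-unique unique m″ ,
    All.lookup inS m″ ∷ takeUntil-all inS m″ , wx ∷ takeUntil-linked linked (there m)
    where
    m″ : w ∈ₗ x ∷ y ∷ ys
    m″ = there (there m)

  module _ {S : Subset n} (no-leaf : NoLeaf G S) where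

    extend-or-close : ∀ {V x y ys} → PathIn G S (x ∷ y ∷ ys) →
      (∀ {z} → z ∈ V → z ∈ₗ x ∷ y ∷ ys) → CycleIn G S ⊎ ∃[ w ] w ∉ V × w ∈ S × E G w x
    extend-or-close {V} path@(_ , x∈S ∷ y∈S ∷ _ , xy ∷ _) V⊆path with no-leaf x∈S y∈S xy
    ... | w , w∈S , xw , w≢y with w ∈? V
    ...   | no w∉V  = inj₂ (w , w∉V , w∈S , E-sym xw)
    ...   | yes w∈V with V⊆path w∈V
    ...     | here refl         = ⊥-elim (E-irrefl xw)
    ...     | there (here refl) = ⊥-elim (w≢y refl)
    ...     | there (there m)   = inj₁ (close-cycle path (E-sym xw) m)

    -- V is the vertex set of the path; the fuel f bounds how often it can still grow.
    grow : ∀ f {x y ys} (V : Subset n) → n ≤ f + ∣ V ∣ → PathIn G S (x ∷ y ∷ ys) →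
           (∀ {z} → z ∈ V → z ∈ₗ x ∷ y ∷ ys) → All (_∈ V) (x ∷ y ∷ ys) → CycleIn G S
    grow f V bound path V⊆path path⊆V with extend-or-close path V⊆path
    grow f       V bound path V⊆path path⊆V | inj₁ cycle = cycle
    grow zero    V bound path V⊆path path⊆V | inj₂ (w , w∉V , _) = ⊥-elim (w∉V (n≤∣p∣⇒x∈p V bound))
    grow (suc f) {x} {y} {ys} V bound (unique , inS , linked) V⊆path path⊆V
      | inj₂ (w , w∉V , w∈S , wx) =
      grow f (V ∪ ⁅ w ⁆) bound′ (fresh ∷ unique , w∈S ∷ inS , wx ∷ linked) V′⊆path′ path′⊆V′
      where
      fresh : All (w ≢_) (x ∷ y ∷ ys)
      fresh = All.map (λ z∈V → λ { refl → w∉V z∈V }) path⊆V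
      bound′ : n ≤ f + ∣ V ∪ ⁅ w ⁆ ∣
      bound′ = subst (n ≤_)
        (trans (sym (+-suc f ∣ V ∣)) (cong (f +_) (sym (x∉p⇒∣p∪⁅x⁆∣≡suc∣p∣ V w w∉V)))) bound
      V′⊆path′ : ∀ {z} → z ∈ V ∪ ⁅ w ⁆ → z ∈ₗ w ∷ x ∷ y ∷ ys
      V′⊆path′ m with x∈p∪q⁻ V ⁅ w ⁆ m
      ... | inj₁ z∈V   = there (V⊆path z∈V)
      ... | inj₂ z∈⁅w⁆ = here (x∈⁅y⁆⇒x≡y w z∈⁅w⁆)
      path′⊆V′ : All (_∈ V ∪ ⁅ w ⁆) (w ∷ x ∷ y ∷ ys)
      path′⊆V′ = x∈p∪q⁺ (inj₂ (x∈⁅x⁆ w)) ∷ All.map (x∈p∪q⁺ ∘ inj₁) path⊆V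

    no-leaf⇒cycle : ∀ {x y} → x ∈ S → y ∈ S → E G x y → CycleIn G S
    no-leaf⇒cycle {x} {y} x∈S y∈S xy =
      grow n (⁅ x ⁆ ∪ ⁅ y ⁆) (m≤m+n n _)
        ((((λ { refl → E-irrefl xy }) ∷ []) ∷ [] ∷ []) , x∈S ∷ y∈S ∷ [] , xy ∷ [-])
        V⊆path (x∈p∪q⁺ (inj₁ (x∈⁅x⁆ x)) ∷ x∈p∪q⁺ (inj₂ (x∈⁅x⁆ y)) ∷ [])
      where
      V⊆path : ∀ {z} → z ∈ ⁅ x ⁆ ∪ ⁅ y ⁆ → z ∈ₗ x ∷ y ∷ []
      V⊆path m with x∈p∪q⁻ ⁅ x ⁆ ⁅ y ⁆ m
      ... | inj₁ z∈⁅x⁆ = here (x∈⁅y⁆⇒x≡y x z∈⁅x⁆)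
      ... | inj₂ z∈⁅y⁆ = there (here (x∈⁅y⁆⇒x≡y y z∈⁅y⁆))

  Exchangeable : Subset n → Subset n → Fin n → Fin n → Set
  Exchangeable I J u v =
    u ∈ I ─ J × v ∈ J ─ I × (NoNeighbourIn G (I - u) v ⊎ NoNeighbourIn G (J - v) u)

  exchangeable? : ∀ I J u v → Dec (Exchangeable I J u v)
  exchangeable? I J u v =
    u ∈? I ─ J ×-dec v ∈? J ─ I ×-dec (noNeighbourIn? (I - u) v ⊎-dec noNeighbourIn? (J - v) u)

  second-neighbour : ∀ {I J p v} → Independent G J → v ∈ J → ¬ NoNeighbourIn G (I - p) v →
                     ∃[ w ] w ∈ I ─ J × E G v w × w ≢ p
  second-neighbour indJ v∈J ¬none with ¬NoNeighbourIn⇒neighbour ¬none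
  ... | w , w∈I-p , wv with x∈p-y⁻ w∈I-p
  ...   | w∈I , w≢p = w , x∈p∧x∉q⇒x∈p─q w∈I (λ w∈J → indJ _ _ w∈J v∈J wv) , E-sym wv , w≢p

  no-exchangeable-pair⇒no-leaf : ∀ {I J} → Independent G I → Independent G J →
    (∀ u v → ¬ Exchangeable I J u v) → NoLeaf G (I Δ J)
  no-exchangeable-pair⇒no-leaf {I} {J} indI indJ none {v} {p} v∈ p∈ vp
    with x∈p∪q⁻ (I ─ J) (J ─ I) v∈ | x∈p∪q⁻ (I ─ J) (J ─ I) p∈
  ... | inj₁ v∈I─J | inj₁ p∈I─J = ⊥-elim (indI v p (proj₁ (x∈p─q⁻ v∈I─J)) (proj₁ (x∈p─q⁻ p∈I─J)) vp)
  ... | inj₂ v∈J─I | inj₂ p∈J─I = ⊥-elim (indJ v p (proj₁ (x∈p─q⁻ v∈J─I)) (proj₁ (x∈p─q⁻ p∈J─I)) vp)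
  ... | inj₂ v∈J─I | inj₁ p∈I─J =
    let w , w∈I─J , vw , w≢p = second-neighbour indJ (proj₁ (x∈p─q⁻ v∈J─I))
                                 (λ nb → none p v (p∈I─J , v∈J─I , inj₁ nb))
    in w , x∈p∪q⁺ (inj₁ w∈I─J) , vw , w≢p
  ... | inj₁ v∈I─J | inj₂ p∈J─I =
    let w , w∈J─I , vw , w≢p = second-neighbour indI (proj₁ (x∈p─q⁻ v∈I─J))
                                 (λ nb → none v p (v∈I─J , p∈J─I , inj₂ nb))
    in w , x∈p∪q⁺ (inj₂ w∈J─I) , vw , w≢p

  no-exchangeable-pair⇒≡ : ∀ {I J} → Independent G I → Independent G J → ∣ I ∣ ≡ ∣ J ∣ →
    ¬ CycleIn G (I Δ J) → (∀ u v → ¬ Exchangeable I J u v) → I ≡ J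
  no-exchangeable-pair⇒≡ {I} {J} indI indJ ∣I∣≡∣J∣ acyclic none with nonempty? (I ─ J)
  ... | no I─J-empty = p⊆q∧∣p∣≡∣q∣⇒p≡q (Empty[p─q]⇒p⊆q I─J-empty) ∣I∣≡∣J∣
  ... | yes (u , u∈I─J) with nonempty? (J ─ I)
  ...   | no J─I-empty =
    ⊥-elim (proj₂ (x∈p─q⁻ u∈I─J) (subst (u ∈_) (sym J≡I) (proj₁ (x∈p─q⁻ u∈I─J))))
    where
    J≡I : J ≡ I
    J≡I = p⊆q∧∣p∣≡∣q∣⇒p≡q (Empty[p─q]⇒p⊆q J─I-empty) (sym ∣I∣≡∣J∣)
  ...   | yes (v , v∈J─I) =
    let w , w∈I─J , vw , _ = second-neighbour indJ (proj₁ (x∈p─q⁻ v∈J─I))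
                               (λ nb → none u v (u∈I─J , v∈J─I , inj₁ nb))
    in ⊥-elim (acyclic (no-leaf⇒cycle (no-exchangeable-pair⇒no-leaf indI indJ none)
                 (x∈p∪q⁺ (inj₂ v∈J─I)) (x∈p∪q⁺ (inj₁ w∈I─J)) vw))

  module _ (connected : Connected G) (claw-free : ClawFree G) where

    reconfigure : ∀ {I J} → Acc _<_ ∣ I Δ J ∣ → Independent G I → Independent G J →
      ∣ I ∣ ≡ ∣ J ∣ → ¬ CycleIn G (I Δ J) → I ⟷TS[ G ] J
    reconfigure {I} {J} (acc rec) indI indJ ∣I∣≡∣J∣ acyclic
      with any? (λ u → any? (λ v → exchangeable? I J u v))
    ... | no ¬pair =
      subst (I ⟷TS[ G ]_)
        (no-exchangeable-pair⇒≡ indI indJ ∣I∣≡∣J∣ acyclic λ u v e → ¬pair (u , v , e)) (done indI)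
    ... | yes (u , v , u∈I─J , v∈J─I , inj₁ none) =
      TSSeq-trans I⟷I′ (reconfigure (rec (p⊂q⇒∣p∣<∣q∣ shrink)) (TSSeq-independentʳ I⟷I′) indJ
                          (trans (∣slide∣ u∈I v∉I) ∣I∣≡∣J∣) (acyclic ∘ CycleIn-mono (p⊂q⇒p⊆q shrink)))
      where
      u∈I : u ∈ I
      u∈I = proj₁ (x∈p─q⁻ u∈I─J)
      v∉I : v ∉ I
      v∉I = proj₂ (x∈p─q⁻ v∈J─I)
      I⟷I′ : I ⟷TS[ G ] slide I u v
      I⟷I′ = slide-along-walk claw-free (connected v u) indI u∈I v∉I none
      shrink : slide I u v Δ J ⊂ I Δ J
      shrink = slide-Δ⊂ u∈I─J (proj₁ (x∈p─q⁻ v∈J─I))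
    ... | yes (u , v , u∈I─J , v∈J─I , inj₂ none) =
      TSSeq-trans (reconfigure (rec (p⊂q⇒∣p∣<∣q∣ shrink)) indI (TSSeq-independentʳ J⟷J′)
                    (trans ∣I∣≡∣J∣ (sym (∣slide∣ v∈J u∉J))) (acyclic ∘ CycleIn-mono (p⊂q⇒p⊆q shrink)))
                  (TSSeq-sym J⟷J′)
      where
      v∈J : v ∈ J
      v∈J = proj₁ (x∈p─q⁻ v∈J─I)
      u∉J : u ∉ J
      u∉J = proj₂ (x∈p─q⁻ u∈I─J)
      J⟷J′ : J ⟷TS[ G ] slide J v u
      J⟷J′ = slide-along-walk claw-free (connected u v) indJ v∈J u∉J none
      shrink : I Δ slide J v u ⊂ I Δ J
      shrink = subst₂ _⊂_ (Δ-comm _ _) (Δ-comm J I) (slide-Δ⊂ v∈J─I (proj₁ (x∈p─q⁻ u∈I─J)))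

lemma2 : ∀ {n} (G : Graph n) (I J : Subset n) →
    Connected G → ClawFree G →
    Independent G I → Independent G J → ∣ I ∣ ≡ ∣ J ∣ →
    ¬ CycleIn G (I Δ J) →
    I ⟷TS[ G ] J
lemma2 G I J connected claw-free indI indJ ∣I∣≡∣J∣ acyclic =
  reconfigure G connected claw-free (<-wellFounded _) indI indJ ∣I∣≡∣J∣ acyclic
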